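{- Let $n\in\mathbb{N}$ and let $L=L(n)$ be its number of decimal digits. If $L\ge 5$, then there exist palindromes $p,p'$, an integer $\ell\in\{L-1,L\}$ and a digit $c\in\{0,\ldots,9\}$ such that $n-p-p'\in\mathbb{N}_{\ell,0}(5^+;c)$.
   Context: Every $n\in\mathbb{N}=\{0,1,2,\ldots\}$ has a unique decimal representation $n=\sum_{j=0}^{L-1}10^j\delta_j$ with digits $\delta_j\in\{0,\ldots,9\}$ and $\delta_{L-1}\ne 0$ whenever $L\ge 2$; $L(n)\coloneqq L$ is the length of $n$ (with $L(0)=1$). The number $n$ is a palindrome if $\delta_j=\delta_{L-1-j}$ for all $0\le j<L$ (so $0$ is a palindrome). For integers $\ell,k\in\mathbb{N}$ with $\ell\ge k+4$ and a digit $c$, $\mathbb{N}_{\ell,k}(5^+;c)$ denotes the set of natural numbers $n$ with $L(n)=\ell$, leading digit $\delta_{\ell-1}\ge 5$, digit $\delta_k=c$, and $10^k\mid n$. -}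

module Defs where

open import Data.Nat using (ℕ; zero; suc; _+_; _*_; _∸_; _^_; _≤_; _<_; _≥_)
open import Data.Nat.DivMod using (_/_; _%_)
open import Data.Nat.Divisibility using (_∣_)
open import Data.Product using (_×_)
open import Relation.Binary.PropositionalEquality using (_≡_)

digit : ℕ → ℕ → ℕ
digit zero    n = n % 10
digit (suc j) n = digit j (n / 10)

-- decimal length with fuel: number of digits, L(0) = 1
lenAux : ℕ → ℕ → ℕ
lenAux zero    n = 1
lenAux (suc f) n with n / 10
... | zero  = 1
... | suc q = suc (lenAux f (suc q))

-- L(n): the length of the decimal representation of n (fuel n suffices)
len : ℕ → ℕ
len n = lenAux n n

Palindrome : ℕ → Set
Palindrome n = ∀ j → j < len n → digit j n ≡ digit (len n ∸ 1 ∸ j) n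

InN : ℕ → ℕ → ℕ → ℕ → Set
InN ℓ k c m = len m ≡ ℓ × 5 ≤ digit (ℓ ∸ 1) m × digit k m ≡ c × (10 ^ k) ∣ m

{-# OPTIONS --safe #-}
module Submission where

-- If the leading digit of n is at least 5, take p = p′ = 0. Otherwise
-- 10^(L-1) ≤ n < 5·10^(L-1), and n is pushed into [5·10^(L-2), 10^(L-1)) by
-- subtracting greedily first a repdigit d·11…1 of length L and then a repdigit
-- e·11…1 of length L - 1; repdigits are palindromes, and each greedy step is
-- shorter than the window it aims at.

open import Defs
open import Data.Nat using (ℕ; zero; suc; _+_; _*_; _∸_; _^_; _≤_; _<_; _≥_; z≤n; s≤s; _≤?_; _<?_; NonZero)
open import Data.Nat.Properties
open import Data.Nat.DivMod
open import Data.Nat.Divisibility using (1∣_)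
open import Data.Nat.Tactic.RingSolver using (solve-∀; solve)
open import Data.Product using (Σ; _×_; _,_)
open import Data.List using ([]; _∷_)
open import Data.Sum using (_⊎_; inj₁; inj₂)
open import Relation.Nullary using (yes; no; contradiction)
open import Relation.Binary.PropositionalEquality using (_≡_; refl; sym; trans; cong; cong₂; subst; module ≡-Reasoning)

m*o≤n⇒m≤n/o : ∀ {m n} o .{{_ : NonZero o}} → m * o ≤ n → m ≤ n / o
m*o≤n⇒m≤n/o {m} o le = subst (_≤ _) (m*n/n≡m m o) (/-monoˡ-≤ o le)

m≤n/o⇒m*o≤n : ∀ {m n} o .{{_ : NonZero o}} → m ≤ n / o → m * o ≤ n
m≤n/o⇒m*o≤n {n = n} o le = ≤-trans (*-monoˡ-≤ o le) (m/n*n≤m n o)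

m/o<n⇒m<n*o : ∀ {m n} o .{{_ : NonZero o}} → m / o < n → m < n * o
m/o<n⇒m<n*o {m} o lt = begin-strict
  m                   ≡⟨ m≡m%n+[m/n]*n m o ⟩
  m % o + m / o * o   <⟨ +-monoˡ-< (m / o * o) (m%n<n m o) ⟩
  suc (m / o) * o     ≤⟨ *-monoˡ-≤ o lt ⟩
  _                   ∎
  where open ≤-Reasoning


m+n≡o⇒m≤o : ∀ {m o} n → m + n ≡ o → m ≤ o
m+n≡o⇒m≤o {m} n refl = m≤m+n m n

lenAux-bounds : ∀ f n → n ≤ f → 1 ≤ n →
  Σ ℕ λ k → lenAux f n ≡ suc k × 10 ^ k ≤ n × n < 10 ^ suc k
lenAux-bounds zero    n n≤0 1≤n = contradiction (≤-trans 1≤n n≤0) λ ()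
lenAux-bounds (suc f) zero _ ()
lenAux-bounds (suc f) n@(suc _) n≤f 1≤n with n / 10 in n/10≡
... | zero  = 0 , refl , 1≤n , m/n≡0⇒m<n n/10≡
... | suc q with lenAux-bounds f (suc q) q<f (s≤s z≤n)
  where
  q<f : suc q ≤ f
  q<f = ≤-pred (≤-trans (subst (_< n) n/10≡ (m/n<m n 10 (s≤s (s≤s z≤n)))) n≤f)
...   | k , lenAux≡ , lo , hi =
  suc k , cong suc lenAux≡ ,
  subst (_≤ n) (*-comm (10 ^ k) 10) (m≤n/o⇒m*o≤n 10 (subst (10 ^ k ≤_) (sym n/10≡) lo)) ,
  subst (n <_) (*-comm (10 ^ suc k) 10) (m/o<n⇒m<n*o 10 (subst (_< 10 ^ suc k) (sym n/10≡) hi))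

len-bounds : ∀ {n} → 1 ≤ n → Σ ℕ λ k → len n ≡ suc k × 10 ^ k ≤ n × n < 10 ^ suc k
len-bounds {n} = lenAux-bounds n n ≤-refl

exponent-≤ : ∀ {j k m} → 10 ^ j ≤ m → m < 10 ^ suc k → j ≤ k
exponent-≤ lo hi = ≮⇒≥ λ k<j → <⇒≱ hi (≤-trans (^-monoʳ-≤ 10 k<j) lo)

len-exact : ∀ {k m} → 10 ^ k ≤ m → m < 10 ^ suc k → len m ≡ suc k
len-exact {k} lo hi with len-bounds (≤-trans (m^n>0 10 k) lo)
... | k′ , len≡ , lo′ , hi′ = trans len≡ (cong suc (≤-antisym (exponent-≤ lo′ hi) (exponent-≤ lo hi′)))

digit-leading≥5 : ∀ k {m} → 5 * 10 ^ k ≤ m → m < 10 ^ suc k → 5 ≤ digit k m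
digit-leading≥5 zero    lo hi = subst (5 ≤_) (sym (m<n⇒m%n≡m hi)) lo
digit-leading≥5 (suc k) {m} lo hi = digit-leading≥5 k
  (m*o≤n⇒m≤n/o 10 (subst (_≤ m) (trans (cong (5 *_) (*-comm 10 (10 ^ k))) (sym (*-assoc 5 (10 ^ k) 10))) lo))
  (m<n*o⇒m/o<n (subst (m <_) (*-comm 10 (10 ^ suc k)) hi))

InN-units : ∀ {k m} → 5 * 10 ^ k ≤ m → m < 10 ^ suc k → InN (suc k) 0 (m % 10) m
InN-units {k} {m} lo hi = len-exact (≤-trans (m≤n*m (10 ^ k) 5) lo) hi , digit-leading≥5 k lo hi , refl , 1∣ m

digit-0 : ∀ j → digit j 0 ≡ 0
digit-0 zero    = refl
digit-0 (suc j) = digit-0 j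

n∸1∸j<n : ∀ {n} j → j < n → n ∸ 1 ∸ j < n
n∸1∸j<n {suc n} j _ = s≤s (m∸n≤m n j)

constant-digits⇒palindrome : ∀ {m} d → (∀ j → j < len m → digit j m ≡ d) → Palindrome m
constant-digits⇒palindrome d δ≡d j j<len = trans (δ≡d j j<len) (sym (δ≡d _ (n∸1∸j<n j j<len)))

palindrome-0 : Palindrome 0
palindrome-0 = constant-digits⇒palindrome 0 λ j _ → digit-0 j

[m+n*10]%10≡m : ∀ {m} n → m < 10 → (m + n * 10) % 10 ≡ m
[m+n*10]%10≡m {m} n m<10 = trans ([m+kn]%n≡m%n m n 10) (m<n⇒m%n≡m m<10)

[m+n*10]/10≡n : ∀ {m} n → m < 10 → (m + n * 10) / 10 ≡ n
[m+n*10]/10≡n {m} n m<10 = ≤-antisym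
  (≤-pred (m<n*o⇒m/o<n (+-monoˡ-< (n * 10) m<10)))
  (m*o≤n⇒m≤n/o 10 (m≤n+m (n * 10) m))

repdigit : ℕ → ℕ → ℕ
repdigit d zero    = 0
repdigit d (suc k) = d + repdigit d k * 10

repunit : ℕ → ℕ
repunit = repdigit 1

repdigit≡d*repunit : ∀ d k → repdigit d k ≡ d * repunit k
repdigit≡d*repunit d zero    = sym (*-zeroʳ d)
repdigit≡d*repunit d (suc k) = begin
  d + repdigit d k * 10   ≡⟨ cong (λ x → d + x * 10) (repdigit≡d*repunit d k) ⟩
  d + d * r * 10          ≡⟨ distrib d r ⟩
  d * (1 + r * 10)        ∎
  where
  open ≡-Reasoning
  r = repunit k
  distrib : ∀ d r → d + d * r * 10 ≡ d * (1 + r * 10)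
  distrib = solve-∀

9*repunit+1≡10^ : ∀ k → 9 * repunit k + 1 ≡ 10 ^ k
9*repunit+1≡10^ zero    = refl
9*repunit+1≡10^ (suc k) = begin
  9 * (1 + r * 10) + 1   ≡⟨ distrib r ⟩
  10 * (9 * r + 1)       ≡⟨ cong (10 *_) (9*repunit+1≡10^ k) ⟩
  10 * 10 ^ k            ∎
  where
  open ≡-Reasoning
  r = repunit k
  distrib : ∀ r → 9 * (1 + r * 10) + 1 ≡ 10 * (9 * r + 1)
  distrib = solve-∀

repdigit<10^ : ∀ {d} k → d < 10 → repdigit d k < 10 ^ k
repdigit<10^ zero    _    = s≤s z≤n
repdigit<10^ {d} (suc k) d<10 = begin-strict
  d + repdigit d k * 10     <⟨ +-monoˡ-< (repdigit d k * 10) d<10 ⟩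
  suc (repdigit d k) * 10   ≤⟨ *-monoˡ-≤ 10 (repdigit<10^ k d<10) ⟩
  10 ^ k * 10               ≡⟨ *-comm (10 ^ k) 10 ⟩
  10 ^ suc k                ∎
  where open ≤-Reasoning

10^≤repdigit : ∀ {d} k → 1 ≤ d → 10 ^ k ≤ repdigit d (suc k)
10^≤repdigit {d} zero    1≤d = ≤-trans 1≤d (m≤m+n d 0)
10^≤repdigit {d} (suc k) 1≤d = begin
  10 ^ suc k                      ≡⟨ *-comm 10 (10 ^ k) ⟩
  10 ^ k * 10                     ≤⟨ *-monoˡ-≤ 10 (10^≤repdigit k 1≤d) ⟩
  repdigit d (suc k) * 10         ≤⟨ m≤n+m _ d ⟩
  d + repdigit d (suc k) * 10     ∎
  where open ≤-Reasoning

digit-repdigit : ∀ {d j k} → d < 10 → j < k → digit j (repdigit d k) ≡ d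
digit-repdigit {d} {zero}  {suc k} d<10 _ = [m+n*10]%10≡m (repdigit d k) d<10
digit-repdigit {d} {suc j} {suc k} d<10 (s≤s j<k) =
  trans (cong (digit j) ([m+n*10]/10≡n (repdigit d k) d<10)) (digit-repdigit d<10 j<k)

repdigit-palindrome : ∀ {d} k → d < 10 → Palindrome (repdigit d k)
repdigit-palindrome zero _ = palindrome-0
repdigit-palindrome {zero} k _ = subst Palindrome (sym (repdigit≡d*repunit 0 k)) palindrome-0
repdigit-palindrome {d@(suc _)} (suc k) d<10 = constant-digits⇒palindrome d λ j j<len →
  digit-repdigit d<10 (subst (j <_) (len-exact {k} (10^≤repdigit k (s≤s z≤n)) (repdigit<10^ (suc k) d<10)) j<len)

reduce-into-window : ∀ {A B R x} j → A ≤ x → A + R ≤ B → x < B + j * R →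
  Σ ℕ λ e → Σ ℕ λ y → e ≤ j × x ≡ y + e * R × A ≤ y × y < B
reduce-into-window {x = x} zero A≤x _ x<B+0 =
  0 , x , z≤n , sym (+-identityʳ x) , A≤x , subst (x <_) (+-identityʳ _) x<B+0
reduce-into-window {A} {B} {R} {x} (suc j) A≤x room x<top with x <? B + j * R
... | yes x<B+jR with reduce-into-window j A≤x room x<B+jR
...   | e , y , e≤j , x≡y+eR , A≤y , y<B = e , y , m≤n⇒m≤1+n e≤j , x≡y+eR , A≤y , y<B
reduce-into-window {A} {B} {R} {x} (suc j) A≤x room x<top | no x≮B+jR =
  suc j , x ∸ S , ≤-refl , sym (m∸n+n≡m S≤x) , m+n≤o⇒m≤o∸n A A+S≤x , x∸S<B
  where
  S = suc j * R
  A+S≤x : A + S ≤ x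
  A+S≤x = ≤-trans (subst (_≤ B + j * R) (+-assoc A R (j * R)) (+-monoˡ-≤ (j * R) room)) (≮⇒≥ x≮B+jR)
  S≤x : S ≤ x
  S≤x = m+n≤o⇒n≤o A A+S≤x
  x∸S<B : x ∸ S < B
  x∸S<B = subst (x ∸ S <_) (m+n∸n≡m B S) (∸-monoˡ-< x<top S≤x)

reduce-twice-into-window : ∀ {A B R S x} j → A ≤ x → A + S ≤ B → A + R ≤ B + j * S →
  x < B + j * S + j * R →
  Σ ℕ λ d → Σ ℕ λ e → Σ ℕ λ y → d ≤ j × e ≤ j × x ≡ y + (d * R + e * S) × A ≤ y × y < B
reduce-twice-into-window {R = R} {S} {x} j A≤x roomS roomR x<top
  with reduce-into-window j A≤x roomR x<top
... | d , y₁ , d≤j , x≡y₁+dR , A≤y₁ , y₁<B+jS with reduce-into-window j A≤y₁ roomS y₁<B+jS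
... | e , y , e≤j , y₁≡y+eS , A≤y , y<B = d , e , y , d≤j , e≤j , x≡y+[dR+eS] , A≤y , y<B
  where
  open ≡-Reasoning
  x≡y+[dR+eS] : x ≡ y + (d * R + e * S)
  x≡y+[dR+eS] = begin
    x                   ≡⟨ x≡y₁+dR ⟩
    y₁ + d * R          ≡⟨ cong (_+ d * R) y₁≡y+eS ⟩
    y + e * S + d * R   ≡⟨ +-assoc y (e * S) (d * R) ⟩
    y + (e * S + d * R) ≡⟨ cong (y +_) (+-comm (e * S) (d * R)) ⟩
    y + (d * R + e * S) ∎

-- With r = repunit (1 + K) we have 10^(1+K) = 9r + 1 and 10^K ≤ r, so the
-- window [5r, 9r + 1) lies inside [5·10^K, 10^(1+K)).
subtract-two-repdigits : ∀ K {n} → 10 ^ suc K ≤ n → n < 5 * 10 ^ suc K →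
  Σ ℕ λ d → Σ ℕ λ e → Σ ℕ λ y → d < 10 × e < 10 ×
  n ≡ y + (repdigit d (2 + K) + repdigit e (1 + K)) × 5 * 10 ^ K ≤ y × y < 10 ^ suc K
subtract-two-repdigits K {n} lo hi =
  let d , e , y , d≤9 , e≤9 , n≡y+[dR+er] , 5r≤y , y<9r+1 =
        reduce-twice-into-window 9 (≤-trans (m+n≤o⇒m≤o (5 * r) (roomS r)) 9r+1≤n) (roomS r) (roomR r) n<top
  in  d , e , y , s≤s d≤9 , s≤s e≤9 ,
      trans n≡y+[dR+er] (sym (cong₂ (λ p p′ → y + (p + p′)) (repdigit≡d*repunit d (2 + K)) (repdigit≡d*repunit e (1 + K)))) ,
      ≤-trans (*-monoʳ-≤ 5 (10^≤repdigit K (s≤s z≤n))) 5r≤y ,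
      subst (y <_) (9*repunit+1≡10^ (suc K)) y<9r+1
  where
  r = repunit (suc K)
  9r+1≤n : 9 * r + 1 ≤ n
  9r+1≤n = subst (_≤ n) (sym (9*repunit+1≡10^ (suc K))) lo
  roomS : ∀ u → 5 * u + u ≤ 9 * u + 1
  roomS u = m+n≡o⇒m≤o (3 * u + 1) (solve (u ∷ []))
  roomR : ∀ u → 5 * u + (1 + u * 10) ≤ 9 * u + 1 + 9 * u
  roomR u = m+n≡o⇒m≤o (3 * u) (solve (u ∷ []))
  top : ∀ u → 5 * (9 * u + 1) ≤ 9 * u + 1 + 9 * u + 9 * (1 + u * 10)
  top u = m+n≡o⇒m≤o (63 * u + 5) (solve (u ∷ []))
  n<top : n < 9 * r + 1 + 9 * r + 9 * repunit (2 + K)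
  n<top = <-≤-trans (subst (λ t → n < 5 * t) (sym (9*repunit+1≡10^ (suc K))) hi) (top r)

PalindromicReduction : ℕ → ℕ → Set
PalindromicReduction n L = Σ ℕ (λ p → Σ ℕ (λ p′ → Σ ℕ (λ ℓ → Σ ℕ (λ c →
  Palindrome p × Palindrome p′ × (ℓ ≡ L ∸ 1 ⊎ ℓ ≡ L) × c < 10 ×
  p + p′ ≤ n × InN ℓ 0 c (n ∸ (p + p′))))))

reduction-of-length : ∀ K {n} → 10 ^ suc K ≤ n → n < 10 ^ suc (suc K) →
  PalindromicReduction n (2 + K)
reduction-of-length K {n} lo hi with 5 * 10 ^ suc K ≤? n
... | yes leading≥5 =
  0 , 0 , 2 + K , n % 10 , palindrome-0 , palindrome-0 , inj₂ refl , m%n<n n 10 , z≤n ,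
  InN-units leading≥5 hi
... | no leading≱5 =
  let d , e , y , d<10 , e<10 , n≡y+P , lo′ , hi′ = subtract-two-repdigits K lo (≰⇒> leading≱5)
      P = repdigit d (2 + K) + repdigit e (1 + K)
  in  repdigit d (2 + K) , repdigit e (1 + K) , 1 + K , y % 10 ,
      repdigit-palindrome (2 + K) d<10 , repdigit-palindrome (1 + K) e<10 , inj₁ refl , m%n<n y 10 ,
      subst (P ≤_) (sym n≡y+P) (m≤n+m P y) ,
      subst (InN (1 + K) 0 (y % 10)) (sym (trans (cong (_∸ P) n≡y+P) (m+n∸n≡m y P))) (InN-units lo′ hi′)

palindromic-reduction : ∀ n → 2 ≤ len n → PalindromicReduction n (len n)
palindromic-reduction zero (s≤s ())
palindromic-reduction n@(suc _) 2≤len with len-bounds {n} (s≤s z≤n)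
... | zero  , len≡1 , _  , _  = contradiction (subst (2 ≤_) len≡1 2≤len) λ { (s≤s ()) }
... | suc K , len≡  , lo , hi = subst (PalindromicReduction n) (sym len≡) (reduction-of-length K lo hi)

lemma2p3 : (n : ℕ) → len n ≥ 5 →
    Σ ℕ (λ p → Σ ℕ (λ p′ → Σ ℕ (λ ℓ → Σ ℕ (λ c →
      Palindrome p × Palindrome p′ × (ℓ ≡ len n ∸ 1 ⊎ ℓ ≡ len n) × c < 10 ×
      p + p′ ≤ n × InN ℓ 0 c (n ∸ (p + p′))))))
lemma2p3 n 5≤len = palindromic-reduction n (≤-trans (s≤s (s≤s z≤n)) 5≤len)
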